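{- Fix an integer $k\ge0$ and let $C_k$ be the set of all sequences $c=(c_1,\dots,c_m)$ of positive integers (of any length $m\ge0$) with $c_1+\dots+c_m=k$ (so $C_0$ consists of the empty sequence). Then, in the field of rational functions in indeterminates $x,y$, \[\sum_{c\in C_k}\Pi(c;x,y)=\frac{1}{[k]_x!}\prod_{i=1}^k\frac{1}{x^iy-1}.\]
   Context: For a sequence of positive integers $c=(c_1,\dots,c_m)$ with $b_i=c_1+\dots+c_i$, $\Pi(c;x,y)=\prod_{i=1}^m\left(\frac{1}{x^{b_i^2}y^{b_i}-1}\cdot\frac{x^{\binom{c_i}{2}}}{[c_i]_x!}\right)$, with $\Pi((\,);x,y)=1$. $[k]_x=\frac{1-x^k}{1-x}$, $[k]_x!=\prod_{i=1}^k[i]_x$. -}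

module Defs where

open import Data.Nat as ℕ using (ℕ; zero; suc; _≡ᵇ_)
open import Data.Nat.Combinatorics using (_C_)
open import Data.Integer as ℤ using (ℤ; +_; -[1+_])
open import Data.Bool using (if_then_else_; _∧_)
open import Data.List using (List; []; _∷_; _++_; map; concatMap; upTo; foldr)
open import Data.Product using (_×_; _,_)
open import Relation.Binary.PropositionalEquality using (_≡_)

-- Polynomials in ℤ[x,y], represented as finite formal sums of terms
-- a·x^i·y^j (a term is (a , i , j)).  Two polynomials are equal iff all
-- their coefficients agree.

Term : Set
Term = ℤ × ℕ × ℕ

Poly : Set
Poly = List Term

coeff : Poly → ℕ → ℕ → ℤ
coeff [] i j = + 0
coeff ((a , p , q) ∷ t) i j =
  (if (p ≡ᵇ i) ∧ (q ≡ᵇ j) then a else + 0) ℤ.+ coeff t i j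

infix 4 _≈P_
_≈P_ : Poly → Poly → Set
p ≈P q = ∀ i j → coeff p i j ≡ coeff q i j

infixl 6 _+P_ _-P_
infixl 7 _*P_

_+P_ : Poly → Poly → Poly
p +P q = p ++ q

-P_ : Poly → Poly
-P p = map (λ { (a , i , j) → (ℤ.- a , i , j) }) p

_-P_ : Poly → Poly → Poly
p -P q = p +P (-P q)

_*P_ : Poly → Poly → Poly
p *P q = concatMap (λ { (a , i , j) → map (λ { (b , k , l) → (a ℤ.* b , i ℕ.+ k , j ℕ.+ l) }) q }) p

mono : ℕ → ℕ → Poly
mono i j = (+ 1 , i , j) ∷ []

1P : Poly
1P = mono 0 0

qInt : ℕ → Poly
qInt k = map (λ i → (+ 1 , i , 0)) (upTo k)

qFact : ℕ → Poly
qFact zero    = 1P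
qFact (suc k) = qFact k *P qInt (suc k)

-- The field of rational functions ℚ(x,y) = Frac(ℤ[x,y]): elements are
-- formal quotients num/den, with num/den ≈ num'/den' iff
-- num·den' = num'·den in ℤ[x,y].  (All denominators occurring below are
-- nonzero polynomials.)

record RatFun : Set where
  constructor _/_
  field
    num : Poly
    den : Poly
open RatFun public

infix 4 _≈_
_≈_ : RatFun → RatFun → Set
(a / b) ≈ (c / d) = a *P d ≈P c *P b

infixl 6 _+F_
infixl 7 _*F_

_+F_ : RatFun → RatFun → RatFun
(a / b) +F (c / d) = (a *P d +P c *P b) / (b *P d)

_*F_ : RatFun → RatFun → RatFun
(a / b) *F (c / d) = (a *P c) / (b *P d)

inv : Poly → RatFun
inv p = 1P / p

0F 1F : RatFun
0F = [] / 1P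
1F = 1P / 1P

sumF : List RatFun → RatFun
sumF = foldr _+F_ 0F

-- Π(c;x,y) = ∏_{i=1}^m 1/(x^{b_i^2} y^{b_i} - 1) · x^{binom(c_i,2)} / [c_i]_x!
-- with b_i = c_1 + ... + c_i.  ΠFrom b c computes the product for the
-- tail c when the partial sum of the preceding parts is b.

ΠFrom : ℕ → List ℕ → RatFun
ΠFrom b []       = 1F
ΠFrom b (c ∷ cs) =
  (inv (mono (b' ℕ.* b') b' -P 1P) *F (mono (c C 2) 0 / qFact c)) *F ΠFrom b' cs
  where b' = b ℕ.+ c

Π : List ℕ → RatFun
Π c = ΠFrom 0 c

rhsProd : ℕ → RatFun
rhsProd zero    = 1F
rhsProd (suc k) = rhsProd k *F inv (mono (suc k) 1 -P 1P)

module Submission where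

open import Defs hiding (_≈_)
open import Data.Nat using (ℕ; _≤_)
open import Data.List using (List; map)
open import Data.Nat.ListAction using (sum)
open import Data.List.Membership.Propositional using (_∈_)
open import Data.List.Relation.Unary.All using (All)
open import Data.List.Relation.Unary.Unique.Propositional using (Unique)
open import Data.Product using (_×_; proj₁)
open import Function.Bundles using (_⇔_; mk⇔; Equivalence)
open import Relation.Binary.PropositionalEquality using (_≡_)
open import Level using (_⊔_)
open import Algebra.Bundles using (CommutativeRing)
import Data.Nat.Properties as ℕ
import Data.List.Relation.Unary.All as All
open import Data.List.Membership.Propositional.Properties.WithK using (unique∧set⇒bag)
open import Data.List.Relation.Binary.BagAndSetEquality using (∼bag⇒↭)
open import Data.List.Relation.Binary.Permutation.Propositional using (_↭_)
import Data.List.Relation.Binary.Permutation.Propositional.Properties as ↭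
import Relation.Binary.PropositionalEquality as ≡

-- Splitting off the last part j of a composition of n gives
-- Π(c′ j) = Π(c′) · x^(j choose 2) / ([j]! (x^(n²) yⁿ - 1)), so the sums Sₙ of Π over
-- the compositions of n satisfy Sₙ = Σⱼ Sₙ₋ⱼ x^(j choose 2) / ([j]! (x^(n²) yⁿ - 1)).
-- The closed form Gₙ = 1 / ([n]! ∏ᵢ₌₁ⁿ (xⁱ y - 1)) satisfies the same recurrence:
-- after clearing denominators it is the q-binomial identity
-- Σⱼ x^(j choose 2) [n over j] ∏ᵢ₌ₙ₋ⱼ₊₁ⁿ (xⁱ y - 1) = x^(n²) yⁿ.
-- The field ℚ(x,y) is modelled by fractions over ℤ[x,y] with non-zero-divisor
-- denominators, and L is a permutation of an explicit enumeration of compositions.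

module PolynomialRing where

  open import Level using (0ℓ)
  open import Data.Nat as ℕ using (ℕ; _≡ᵇ_)
  import Data.Nat.Properties as ℕ
  open import Data.Integer as ℤ using (ℤ; +_; 0ℤ; 1ℤ)
  import Data.Integer.Properties as ℤ
  open import Data.Integer.Solver using (module +-*-Solver)
  open import Data.Bool using (true; false; if_then_else_; _∧_)
  open import Data.List using ([]; _∷_; _++_; map)
  open import Data.Maybe using (Maybe; nothing; just)
  open import Relation.Nullary using (yes; no)
  open import Data.Product using (_,_)
  open import Algebra.Bundles using (CommutativeRing)
  open import Algebra.Structures using (IsCommutativeRing)
  open import Algebra.Solver.Ring.AlmostCommutativeRing
    using (fromCommutativeRing; _-Raw-AlmostCommutative⟶_)
  import Algebra.Solver.Ring
  open import Relation.Binary.PropositionalEquality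
  open ≡-Reasoning

  -- Pairing Σₖ aₖ x^iₖ y^jₖ with a test function f gives Σₖ aₖ f iₖ jₖ.  Under
  -- pairing, products become compositions of functionals, so every ring law of
  -- ℤ[x,y] reduces to one of ℤ.

  ⟪_⟫ : Poly → (ℕ → ℕ → ℤ) → ℤ
  ⟪ [] ⟫              f = 0ℤ
  ⟪ (a , i , j) ∷ p ⟫ f = a ℤ.* f i j ℤ.+ ⟪ p ⟫ f

  shift : ℕ → ℕ → (ℕ → ℕ → ℤ) → ℕ → ℕ → ℤ
  shift i j f k l = f (i ℕ.+ k) (j ℕ.+ l)

  infix 4 _≃_
  record _≃_ (p q : Poly) : Set where
    constructor pairing-ext
    field pairing-≡ : ∀ f → ⟪ p ⟫ f ≡ ⟪ q ⟫ f
  open _≃_ public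

  ⟪⟫-cong : ∀ p {f g} → (∀ i j → f i j ≡ g i j) → ⟪ p ⟫ f ≡ ⟪ p ⟫ g
  ⟪⟫-cong []              f≗g = refl
  ⟪⟫-cong ((a , i , j) ∷ p) f≗g = cong₂ (λ u v → a ℤ.* u ℤ.+ v) (f≗g i j) (⟪⟫-cong p f≗g)

  ⟪⟫-zero : ∀ p → ⟪ p ⟫ (λ _ _ → 0ℤ) ≡ 0ℤ
  ⟪⟫-zero []                = refl
  ⟪⟫-zero ((a , i , j) ∷ p) rewrite ⟪⟫-zero p | ℤ.*-zeroʳ a = refl

  ⟪⟫-linear : ∀ p (c : ℤ) f g →
    ⟪ p ⟫ (λ i j → c ℤ.* f i j ℤ.+ g i j) ≡ c ℤ.* ⟪ p ⟫ f ℤ.+ ⟪ p ⟫ g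
  ⟪⟫-linear []                c f g = sym (trans (ℤ.+-identityʳ _) (ℤ.*-zeroʳ c))
  ⟪⟫-linear ((a , i , j) ∷ p) c f g rewrite ⟪⟫-linear p c f g =
    solve 6 (λ a c x y u v → a :* (c :* x :+ y) :+ (c :* u :+ v) := c :* (a :* x :+ u) :+ (a :* y :+ v))
      refl a c (f i j) (g i j) (⟪ p ⟫ f) (⟪ p ⟫ g)
    where open +-*-Solver

  ⟪⟫-+ : ∀ p f g → ⟪ p ⟫ (λ i j → f i j ℤ.+ g i j) ≡ ⟪ p ⟫ f ℤ.+ ⟪ p ⟫ g
  ⟪⟫-+ p f g = begin
    ⟪ p ⟫ (λ i j → f i j ℤ.+ g i j)        ≡⟨ ⟪⟫-cong p (λ i j → cong (ℤ._+ g i j) (sym (ℤ.*-identityˡ (f i j)))) ⟩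
    ⟪ p ⟫ (λ i j → 1ℤ ℤ.* f i j ℤ.+ g i j) ≡⟨ ⟪⟫-linear p 1ℤ f g ⟩
    1ℤ ℤ.* ⟪ p ⟫ f ℤ.+ ⟪ p ⟫ g            ≡⟨ cong (ℤ._+ ⟪ p ⟫ g) (ℤ.*-identityˡ (⟪ p ⟫ f)) ⟩
    ⟪ p ⟫ f ℤ.+ ⟪ p ⟫ g                   ∎

  ⟪⟫-swap : ∀ p q (g : ℕ → ℕ → ℕ → ℕ → ℤ) →
    ⟪ p ⟫ (λ i j → ⟪ q ⟫ (g i j)) ≡ ⟪ q ⟫ (λ k l → ⟪ p ⟫ (λ i j → g i j k l))
  ⟪⟫-swap []                q g = sym (⟪⟫-zero q)
  ⟪⟫-swap ((a , i , j) ∷ p) q g =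
    trans (cong (λ v → a ℤ.* ⟪ q ⟫ (g i j) ℤ.+ v) (⟪⟫-swap p q g)) (sym (⟪⟫-linear q a (g i j) _))

  ⟪⟫-++ : ∀ p q f → ⟪ p ++ q ⟫ f ≡ ⟪ p ⟫ f ℤ.+ ⟪ q ⟫ f
  ⟪⟫-++ []                q f = sym (ℤ.+-identityˡ _)
  ⟪⟫-++ ((a , i , j) ∷ p) q f rewrite ⟪⟫-++ p q f = sym (ℤ.+-assoc (a ℤ.* f i j) _ _)

  ⟪⟫-neg : ∀ p f → ⟪ -P p ⟫ f ≡ ℤ.- ⟪ p ⟫ f
  ⟪⟫-neg []                f = refl
  ⟪⟫-neg ((a , i , j) ∷ p) f = begin
    ℤ.- a ℤ.* f i j ℤ.+ ⟪ -P p ⟫ f       ≡⟨ cong₂ ℤ._+_ (sym (ℤ.neg-distribˡ-* a (f i j))) (⟪⟫-neg p f) ⟩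
    ℤ.- (a ℤ.* f i j) ℤ.+ ℤ.- ⟪ p ⟫ f    ≡⟨ sym (ℤ.neg-distrib-+ (a ℤ.* f i j) (⟪ p ⟫ f)) ⟩
    ℤ.- (a ℤ.* f i j ℤ.+ ⟪ p ⟫ f)        ∎

  -- The inner function of _*P_ is anonymous, so it is characterised by its action.
  ⟪⟫-scaled : ∀ {a i j} (g : Term → Term) → (∀ b k l → g (b , k , l) ≡ (a ℤ.* b , i ℕ.+ k , j ℕ.+ l)) →
    ∀ q f → ⟪ map g q ⟫ f ≡ a ℤ.* ⟪ q ⟫ (shift i j f)
  ⟪⟫-scaled {a}         g g-def []                f = sym (ℤ.*-zeroʳ a)
  ⟪⟫-scaled {a} {i} {j} g g-def ((b , k , l) ∷ q) f rewrite g-def b k l | ⟪⟫-scaled {a} {i} {j} g g-def q f =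
    solve 4 (λ a b x y → a :* b :* x :+ a :* y := a :* (b :* x :+ y))
      refl a b (f (i ℕ.+ k) (j ℕ.+ l)) (⟪ q ⟫ (shift i j f))
    where open +-*-Solver

  ⟪⟫-* : ∀ p q f → ⟪ p *P q ⟫ f ≡ ⟪ p ⟫ (λ i j → ⟪ q ⟫ (shift i j f))
  ⟪⟫-* []                q f = refl
  ⟪⟫-* ((a , i , j) ∷ p) q f =
    trans (⟪⟫-++ (map _ q) (p *P q) f)
          (cong₂ ℤ._+_ (⟪⟫-scaled {a} {i} {j} _ (λ _ _ _ → refl) q f) (⟪⟫-* p q f))

  ≃-refl : ∀ {p} → p ≃ p
  ≃-refl = pairing-ext λ _ → refl

  +P-cong : ∀ {p p′ q q′} → p ≃ p′ → q ≃ q′ → p +P q ≃ p′ +P q′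
  +P-cong {p} {p′} {q} {q′} p≃p′ q≃q′ = pairing-ext λ f → begin
    ⟪ p ++ q ⟫ f          ≡⟨ ⟪⟫-++ p q f ⟩
    ⟪ p ⟫ f ℤ.+ ⟪ q ⟫ f   ≡⟨ cong₂ ℤ._+_ (pairing-≡ p≃p′ f) (pairing-≡ q≃q′ f) ⟩
    ⟪ p′ ⟫ f ℤ.+ ⟪ q′ ⟫ f ≡⟨ sym (⟪⟫-++ p′ q′ f) ⟩
    ⟪ p′ ++ q′ ⟫ f        ∎

  *P-cong : ∀ {p p′ q q′} → p ≃ p′ → q ≃ q′ → p *P q ≃ p′ *P q′
  *P-cong {p} {p′} {q} {q′} p≃p′ q≃q′ = pairing-ext λ f → begin
    ⟪ p *P q ⟫ f                              ≡⟨ ⟪⟫-* p q f ⟩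
    ⟪ p ⟫ (λ i j → ⟪ q ⟫ (shift i j f))       ≡⟨ pairing-≡ p≃p′ _ ⟩
    ⟪ p′ ⟫ (λ i j → ⟪ q ⟫ (shift i j f))      ≡⟨ ⟪⟫-cong p′ (λ i j → pairing-≡ q≃q′ _) ⟩
    ⟪ p′ ⟫ (λ i j → ⟪ q′ ⟫ (shift i j f))     ≡⟨ sym (⟪⟫-* p′ q′ f) ⟩
    ⟪ p′ *P q′ ⟫ f                            ∎

  -P-cong : ∀ {p q} → p ≃ q → -P p ≃ -P q
  -P-cong {p} {q} p≃q = pairing-ext λ f →
    trans (⟪⟫-neg p f) (trans (cong ℤ.-_ (pairing-≡ p≃q f)) (sym (⟪⟫-neg q f)))

  Poly-isCommutativeRing : IsCommutativeRing _≃_ _+P_ _*P_ -P_ [] 1P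
  Poly-isCommutativeRing = record
    { isRing = record
      { +-isAbelianGroup = record
        { isGroup = record
          { isMonoid = record
            { isSemigroup = record
              { isMagma = record
                { isEquivalence = record
                  { refl  = ≃-refl
                  ; sym   = λ p≃q → pairing-ext λ f → sym (pairing-≡ p≃q f)
                  ; trans = λ p≃q q≃r → pairing-ext λ f → trans (pairing-≡ p≃q f) (pairing-≡ q≃r f)
                  }
                ; ∙-cong = +P-cong
                }
              ; assoc = λ p q r → pairing-ext λ f → ++-assoc p q r f
              }
            ; identity = (λ p → ≃-refl) , (λ p → pairing-ext λ f → trans (⟪⟫-++ p [] f) (ℤ.+-identityʳ _))
            }
          ; inverse = (λ p → pairing-ext λ f → trans (⟪⟫-++ (-P p) p f)
                                (trans (cong (ℤ._+ ⟪ p ⟫ f) (⟪⟫-neg p f)) (ℤ.+-inverseˡ (⟪ p ⟫ f))))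
                    , (λ p → pairing-ext λ f → trans (⟪⟫-++ p (-P p) f)
                                (trans (cong (λ v → ⟪ p ⟫ f ℤ.+ v) (⟪⟫-neg p f)) (ℤ.+-inverseʳ (⟪ p ⟫ f))))
          ; ⁻¹-cong = -P-cong
          }
        ; comm = λ p q → pairing-ext λ f →
            trans (⟪⟫-++ p q f) (trans (ℤ.+-comm (⟪ p ⟫ f) (⟪ q ⟫ f)) (sym (⟪⟫-++ q p f)))
        }
      ; *-cong = *P-cong
      ; *-assoc = *P-assoc
      ; *-identity = (λ p → pairing-ext λ f → trans (⟪⟫-* 1P p f) (trans (ℤ.+-identityʳ _) (ℤ.*-identityˡ _)))
                   , (λ p → pairing-ext λ f → trans (⟪⟫-* p 1P f) (⟪⟫-cong p λ i j →
                        trans (ℤ.+-identityʳ _) (trans (ℤ.*-identityˡ _) (cong₂ f (ℕ.+-identityʳ i) (ℕ.+-identityʳ j)))))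
      ; distrib = *P-distribˡ , *P-distribʳ
      }
    ; *-comm = *P-comm
    }
    where
    ++-assoc : ∀ p q r f → ⟪ (p ++ q) ++ r ⟫ f ≡ ⟪ p ++ (q ++ r) ⟫ f
    ++-assoc p q r f rewrite ⟪⟫-++ (p ++ q) r f | ⟪⟫-++ p q f | ⟪⟫-++ p (q ++ r) f | ⟪⟫-++ q r f =
      ℤ.+-assoc (⟪ p ⟫ f) (⟪ q ⟫ f) (⟪ r ⟫ f)

    *P-assoc : ∀ p q r → (p *P q) *P r ≃ p *P (q *P r)
    *P-assoc p q r = pairing-ext λ f → begin
      ⟪ (p *P q) *P r ⟫ f
        ≡⟨ trans (⟪⟫-* (p *P q) r f) (⟪⟫-* p q _) ⟩
      ⟪ p ⟫ (λ i j → ⟪ q ⟫ (λ k l → ⟪ r ⟫ (shift (i ℕ.+ k) (j ℕ.+ l) f)))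
        ≡⟨ ⟪⟫-cong p (λ i j → ⟪⟫-cong q λ k l → ⟪⟫-cong r λ m n →
             cong₂ f (ℕ.+-assoc i k m) (ℕ.+-assoc j l n)) ⟩
      ⟪ p ⟫ (λ i j → ⟪ q ⟫ (λ k l → ⟪ r ⟫ (shift k l (shift i j f))))
        ≡⟨ sym (trans (⟪⟫-* p (q *P r) f) (⟪⟫-cong p λ i j → ⟪⟫-* q r _)) ⟩
      ⟪ p *P (q *P r) ⟫ f ∎

    *P-comm : ∀ p q → p *P q ≃ q *P p
    *P-comm p q = pairing-ext λ f → begin
      ⟪ p *P q ⟫ f                                   ≡⟨ ⟪⟫-* p q f ⟩
      ⟪ p ⟫ (λ i j → ⟪ q ⟫ (shift i j f))            ≡⟨ ⟪⟫-swap p q _ ⟩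
      ⟪ q ⟫ (λ k l → ⟪ p ⟫ (λ i j → shift i j f k l)) ≡⟨ ⟪⟫-cong q (λ k l → ⟪⟫-cong p λ i j →
                                                           cong₂ f (ℕ.+-comm i k) (ℕ.+-comm j l)) ⟩
      ⟪ q ⟫ (λ k l → ⟪ p ⟫ (shift k l f))            ≡⟨ sym (⟪⟫-* q p f) ⟩
      ⟪ q *P p ⟫ f                                   ∎

    *P-distribˡ : ∀ p q r → p *P (q +P r) ≃ p *P q +P p *P r
    *P-distribˡ p q r = pairing-ext λ f → begin
      ⟪ p *P (q ++ r) ⟫ f                                             ≡⟨ ⟪⟫-* p (q ++ r) f ⟩
      ⟪ p ⟫ (λ i j → ⟪ q ++ r ⟫ (shift i j f))                        ≡⟨ ⟪⟫-cong p (λ i j → ⟪⟫-++ q r _) ⟩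
      ⟪ p ⟫ (λ i j → ⟪ q ⟫ (shift i j f) ℤ.+ ⟪ r ⟫ (shift i j f))     ≡⟨ ⟪⟫-+ p _ _ ⟩
      ⟪ p ⟫ (λ i j → ⟪ q ⟫ (shift i j f)) ℤ.+ ⟪ p ⟫ (λ i j → ⟪ r ⟫ (shift i j f))
                                                                      ≡⟨ sym (cong₂ ℤ._+_ (⟪⟫-* p q f) (⟪⟫-* p r f)) ⟩
      ⟪ p *P q ⟫ f ℤ.+ ⟪ p *P r ⟫ f                                   ≡⟨ sym (⟪⟫-++ (p *P q) (p *P r) f) ⟩
      ⟪ p *P q ++ p *P r ⟫ f                                          ∎

    *P-distribʳ : ∀ r p q → (p +P q) *P r ≃ p *P r +P q *P r
    *P-distribʳ r p q = pairing-ext λ f →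
      trans (pairing-≡ (*P-comm (p +P q) r) f) (trans (pairing-≡ (*P-distribˡ r p q) f)
        (pairing-≡ (+P-cong (*P-comm r p) (*P-comm r q)) f))

  Poly-commutativeRing : CommutativeRing 0ℓ 0ℓ
  Poly-commutativeRing = record { isCommutativeRing = Poly-isCommutativeRing }

  -- Coefficients are pairings with indicator functions.
  ≃⇒≈P : ∀ {p q} → p ≃ q → p ≈P q
  ≃⇒≈P {p} {q} p≃q i j = trans (coeff-pairing p) (trans (pairing-≡ p≃q _) (sym (coeff-pairing q)))
    where
    δ : ℕ → ℕ → ℤ
    δ k l = if (k ≡ᵇ i) ∧ (l ≡ᵇ j) then 1ℤ else 0ℤ

    coeff-pairing : ∀ p → coeff p i j ≡ ⟪ p ⟫ δ
    coeff-pairing []                = refl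
    coeff-pairing ((a , k , l) ∷ p) = cong₂ ℤ._+_ (select ((k ≡ᵇ i) ∧ (l ≡ᵇ j))) (coeff-pairing p)
      where
      select : ∀ b → (if b then a else 0ℤ) ≡ a ℤ.* (if b then 1ℤ else 0ℤ)
      select true  = sym (ℤ.*-identityʳ a)
      select false = sym (ℤ.*-zeroʳ a)

  constant : ℤ → Poly
  constant a = (a , 0 , 0) ∷ []

  ℤ⟶Poly : ℤ.+-*-rawRing -Raw-AlmostCommutative⟶ fromCommutativeRing Poly-commutativeRing
  ℤ⟶Poly = record
    { ⟦_⟧    = constant
    ; +-homo = λ a b → pairing-ext λ f →
        solve 3 (λ a b x → (a :+ b) :* x :+ con 0ℤ := a :* x :+ (b :* x :+ con 0ℤ)) refl a b (f 0 0)
    ; *-homo = λ a b → ≃-refl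
    ; -‿homo = λ a → ≃-refl
    ; 0-homo = pairing-ext λ f → trans (ℤ.+-identityʳ _) (ℤ.*-zeroˡ (f 0 0))
    ; 1-homo = ≃-refl
    }
    where open +-*-Solver

  constant-≟ : ∀ a b → Maybe (constant a ≃ constant b)
  constant-≟ a b with a ℤ.≟ b
  ... | yes refl = just ≃-refl
  ... | no _     = nothing

  module PolySolver =
    Algebra.Solver.Ring ℤ.+-*-rawRing (fromCommutativeRing Poly-commutativeRing) ℤ⟶Poly constant-≟

module Fractions {c ℓ} (R : CommutativeRing c ℓ) where

  open import Data.Product using (_,_)
  open import Data.Nat using (ℕ; zero; suc)
  open import Data.List using (List; []; _∷_; _++_; map; foldr; concat; applyUpTo)
  open import Data.List.Relation.Unary.All using (All; []; _∷_)
  open import Data.List.Relation.Binary.Permutation.Propositional using (_↭_; ↭⇒↭ₛ′)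
  open import Data.Fin using (zero; suc; toℕ)
  open import Data.Vec.Functional using (Vector)
  open import Function using (_∘_)
  import Algebra.Properties.Semiring.Sum
  open import Algebra.Structures using (IsCommutativeRing)

  open CommutativeRing R hiding (zero)
  open import Algebra.Properties.Ring ring
    using (x∙y⁻¹≈ε⇒x≈y; x≈y⇒x∙y⁻¹≈ε; x[y-z]≈xy-xz; -‿distribˡ-*)
  open import Relation.Binary.Reasoning.Setoid setoid
  -- Natural-number coefficients suffice for the negation-free identities below;
  -- the solver cannot use coefficients from an arbitrary R, whose equality is undecidable.
  open import Algebra.Solver.Ring.NaturalCoefficients.Default commutativeSemiring

  Regular : Carrier → Set (c ⊔ ℓ)
  Regular d = ∀ {q} → d * q ≈ 0# → q ≈ 0#

  regular-1# : Regular 1#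
  regular-1# {q} 1q≈0 = trans (sym (*-identityˡ q)) 1q≈0

  regular-* : ∀ {d e} → Regular d → Regular e → Regular (d * e)
  regular-* {d} {e} reg-d reg-e {q} deq≈0 = reg-e (reg-d (trans (sym (*-assoc d e q)) deq≈0))

  *-cancelˡ-regular : ∀ {d x y} → Regular d → d * x ≈ d * y → x ≈ y
  *-cancelˡ-regular {d} {x} {y} reg-d dx≈dy = x∙y⁻¹≈ε⇒x≈y x y (reg-d (begin
    d * (x - y)     ≈⟨ x[y-z]≈xy-xz d x y ⟩
    d * x - d * y   ≈⟨ x≈y⇒x∙y⁻¹≈ε dx≈dy ⟩
    0#              ∎))

  -- Without eta, fraction metavariables are not expanded during unification and
  -- the polynomial entries of fractions are not normalised needlessly.
  record Fraction : Set (c ⊔ ℓ) where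
    no-eta-equality; pattern
    constructor frac
    field
      numerator   : Carrier
      denominator : Carrier
      regular     : Regular denominator
  open Fraction public

  infix 4 _≈ᶠ_
  record _≈ᶠ_ (p q : Fraction) : Set ℓ where
    constructor cross
    field cross-≈ : numerator p * denominator q ≈ numerator q * denominator p
  open _≈ᶠ_ public

  infixl 6 _+ᶠ_
  infixl 7 _*ᶠ_

  _+ᶠ_ : Fraction → Fraction → Fraction
  frac a b rb +ᶠ frac c d rd = frac (a * d + c * b) (b * d) (regular-* rb rd)

  _*ᶠ_ : Fraction → Fraction → Fraction
  frac a b rb *ᶠ frac c d rd = frac (a * c) (b * d) (regular-* rb rd)

  -ᶠ_ : Fraction → Fraction
  -ᶠ frac a b rb = frac (- a) b rb

  0ᶠ 1ᶠ : Fraction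
  0ᶠ = frac 0# 1# regular-1#
  1ᶠ = frac 1# 1# regular-1#

  ≈ᶠ-trans : ∀ {p q r} → p ≈ᶠ q → q ≈ᶠ r → p ≈ᶠ r
  ≈ᶠ-trans {frac a b _} {frac c d rd} {frac e f _} (cross ad≈cb) (cross cf≈ed) =
    cross (*-cancelˡ-regular rd (begin
      d * (a * f)   ≈⟨ solve 3 (λ d a f → d :* (a :* f) := (a :* d) :* f) refl d a f ⟩
      (a * d) * f   ≈⟨ *-congʳ ad≈cb ⟩
      (c * b) * f   ≈⟨ solve 3 (λ c b f → (c :* b) :* f := (c :* f) :* b) refl c b f ⟩
      (c * f) * b   ≈⟨ *-congʳ cf≈ed ⟩
      (e * d) * b   ≈⟨ solve 3 (λ e d b → (e :* d) :* b := d :* (e :* b)) refl e d b ⟩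
      d * (e * b)   ∎))

  +ᶠ-cong : ∀ {p p′ q q′} → p ≈ᶠ p′ → q ≈ᶠ q′ → p +ᶠ q ≈ᶠ p′ +ᶠ q′
  +ᶠ-cong {frac a b _} {frac a′ b′ _} {frac c d _} {frac c′ d′ _} (cross ab′≈a′b) (cross cd′≈c′d) =
    cross (begin
      (a * d + c * b) * (b′ * d′)
        ≈⟨ solve 6 (λ a b c d b′ d′ → (a :* d :+ c :* b) :* (b′ :* d′) := (a :* b′) :* (d :* d′) :+ (c :* d′) :* (b :* b′))
             refl a b c d b′ d′ ⟩
      (a * b′) * (d * d′) + (c * d′) * (b * b′)
        ≈⟨ +-cong (*-congʳ ab′≈a′b) (*-congʳ cd′≈c′d) ⟩
      (a′ * b) * (d * d′) + (c′ * d) * (b * b′)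
        ≈⟨ solve 6 (λ a′ b c′ d b′ d′ → (a′ :* b) :* (d :* d′) :+ (c′ :* d) :* (b :* b′) := (a′ :* d′ :+ c′ :* b′) :* (b :* d))
             refl a′ b c′ d b′ d′ ⟩
      (a′ * d′ + c′ * b′) * (b * d) ∎)

  *ᶠ-cong : ∀ {p p′ q q′} → p ≈ᶠ p′ → q ≈ᶠ q′ → p *ᶠ q ≈ᶠ p′ *ᶠ q′
  *ᶠ-cong {frac a b _} {frac a′ b′ _} {frac c d _} {frac c′ d′ _} (cross ab′≈a′b) (cross cd′≈c′d) =
    cross (begin
      (a * c) * (b′ * d′)   ≈⟨ solve 6 (λ a b c d b′ d′ → (a :* c) :* (b′ :* d′) := (a :* b′) :* (c :* d′)) refl a b c d b′ d′ ⟩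
      (a * b′) * (c * d′)   ≈⟨ *-cong ab′≈a′b cd′≈c′d ⟩
      (a′ * b) * (c′ * d)   ≈⟨ solve 6 (λ a′ b c′ d b′ d′ → (a′ :* b) :* (c′ :* d) := (a′ :* c′) :* (b :* d)) refl a′ b c′ d b′ d′ ⟩
      (a′ * c′) * (b * d)   ∎)

  -ᶠ-cong : ∀ {p q} → p ≈ᶠ q → -ᶠ p ≈ᶠ -ᶠ q
  -ᶠ-cong {frac a b _} {frac a′ b′ _} (cross ab′≈a′b) = cross (begin
    - a * b′     ≈⟨ -‿distribˡ-* a b′ ⟨
    - (a * b′)   ≈⟨ -‿cong ab′≈a′b ⟩
    - (a′ * b)   ≈⟨ -‿distribˡ-* a′ b ⟩
    - a′ * b     ∎)

  -ᶠ-inverseˡ : ∀ p → -ᶠ p +ᶠ p ≈ᶠ 0ᶠ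
  -ᶠ-inverseˡ (frac a b _) = cross (begin
    (- a * b + a * b) * 1#   ≈⟨ *-identityʳ _ ⟩
    - a * b + a * b          ≈⟨ distribʳ b (- a) a ⟨
    (- a + a) * b            ≈⟨ *-congʳ (-‿inverseˡ a) ⟩
    0# * b                   ≈⟨ zeroˡ b ⟩
    0#                       ≈⟨ zeroˡ (b * b) ⟨
    0# * (b * b)             ∎)

  -ᶠ-inverseʳ : ∀ p → p +ᶠ -ᶠ p ≈ᶠ 0ᶠ
  -ᶠ-inverseʳ (frac a b _) = cross (begin
    (a * b + - a * b) * 1#   ≈⟨ *-identityʳ _ ⟩
    a * b + - a * b          ≈⟨ distribʳ b a (- a) ⟨
    (a + - a) * b            ≈⟨ *-congʳ (-‿inverseʳ a) ⟩
    0# * b                   ≈⟨ zeroˡ b ⟩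
    0#                       ≈⟨ zeroˡ (b * b) ⟨
    0# * (b * b)             ∎)

  Fraction-isCommutativeRing : IsCommutativeRing _≈ᶠ_ _+ᶠ_ _*ᶠ_ -ᶠ_ 0ᶠ 1ᶠ
  Fraction-isCommutativeRing = record
    { isRing = record
      { +-isAbelianGroup = record
        { isGroup = record
          { isMonoid = record
            { isSemigroup = record
              { isMagma = record
                { isEquivalence = record
                  { refl = cross refl ; sym = λ (cross e) → cross (sym e) ; trans = ≈ᶠ-trans }
                ; ∙-cong = +ᶠ-cong
                }
              ; assoc = λ { (frac a b _) (frac c d _) (frac e f _) → cross (solve 6
                  (λ a b c d e f → ((a :* d :+ c :* b) :* f :+ e :* (b :* d)) :* (b :* (d :* f))
                                := (a :* (d :* f) :+ (c :* f :+ e :* d) :* b) :* ((b :* d) :* f))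
                  refl a b c d e f) }
              }
            ; identity = (λ { (frac a b _) → cross (solve 2
                             (λ a b → (con 0 :* b :+ a :* con 1) :* b := a :* (con 1 :* b)) refl a b) })
                       , (λ { (frac a b _) → cross (solve 2
                             (λ a b → (a :* con 1 :+ con 0 :* b) :* b := a :* (b :* con 1)) refl a b) })
            }
          ; inverse = -ᶠ-inverseˡ , -ᶠ-inverseʳ
          ; ⁻¹-cong = -ᶠ-cong
          }
        ; comm = λ { (frac a b _) (frac c d _) → cross (solve 4
                   (λ a b c d → (a :* d :+ c :* b) :* (d :* b) := (c :* b :+ a :* d) :* (b :* d)) refl a b c d) }
        }
      ; *-cong = *ᶠ-cong
      ; *-assoc = λ { (frac a b _) (frac c d _) (frac e f _) → cross (solve 6
          (λ a b c d e f → ((a :* c) :* e) :* (b :* (d :* f)) := (a :* (c :* e)) :* ((b :* d) :* f))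
          refl a b c d e f) }
      ; *-identity = (λ { (frac a b _) → cross (solve 2
                        (λ a b → (con 1 :* a) :* b := a :* (con 1 :* b)) refl a b) })
                   , (λ { (frac a b _) → cross (solve 2
                        (λ a b → (a :* con 1) :* b := a :* (b :* con 1)) refl a b) })
      ; distrib = (λ { (frac a b _) (frac c d _) (frac e f _) → cross (solve 6
                      (λ a b c d e f → (a :* (c :* f :+ e :* d)) :* ((b :* d) :* (b :* f))
                                    := ((a :* c) :* (b :* f) :+ (a :* e) :* (b :* d)) :* (b :* (d :* f)))
                      refl a b c d e f) })
                , (λ { (frac a b _) (frac c d _) (frac e f _) → cross (solve 6
                      (λ a b c d e f → ((c :* f :+ e :* d) :* a) :* ((d :* b) :* (f :* b))
                                    := ((c :* a) :* (f :* b) :+ (e :* a) :* (d :* b)) :* ((d :* f) :* b))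
                      refl a b c d e f) })
      }
    ; *-comm = λ { (frac a b _) (frac c d _) → cross (solve 4
        (λ a b c d → (a :* c) :* (d :* b) := (c :* a) :* (b :* d)) refl a b c d) }
    }

  Fraction-commutativeRing : CommutativeRing (c ⊔ ℓ) ℓ
  Fraction-commutativeRing = record { isCommutativeRing = Fraction-isCommutativeRing }

  private
    module Sumᴿ = Algebra.Properties.Semiring.Sum semiring
    module Sumᶠ = Algebra.Properties.Semiring.Sum (CommutativeRing.semiring Fraction-commutativeRing)
    module F = CommutativeRing Fraction-commutativeRing

  ∑ᶠ : ∀ {n} → Vector Fraction n → Fraction
  ∑ᶠ = Sumᶠ.sum

  ∑ᶠ-cong : ∀ {n} {x y : Vector Fraction n} → (∀ j → x j ≈ᶠ y j) → ∑ᶠ x ≈ᶠ ∑ᶠ y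
  ∑ᶠ-cong = Sumᶠ.sum-cong-≋

  ∑-common-denominator : ∀ {n} (f : Vector Carrier n) d (reg-d : Regular d) →
    ∑ᶠ (λ j → frac (f j) d reg-d) ≈ᶠ frac (Sumᴿ.sum f) d reg-d
  ∑-common-denominator {zero}  f d reg-d = cross (trans (zeroˡ d) (sym (zeroˡ 1#)))
  ∑-common-denominator {suc n} f d reg-d =
    ≈ᶠ-trans (+ᶠ-cong {frac (f zero) d reg-d} {frac (f zero) d reg-d} (cross refl) (∑-common-denominator (f ∘ suc) d reg-d))
      (cross (solve 3 (λ a b d → (a :* d :+ b :* d) :* d := (a :+ b) :* (d :* d)) refl (f zero) (Sumᴿ.sum (f ∘ suc)) d))

  ∑ˡ : List Fraction → Fraction
  ∑ˡ = foldr _+ᶠ_ 0ᶠ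

  ∑ˡ-++ : ∀ xs ys → ∑ˡ (xs ++ ys) ≈ᶠ ∑ˡ xs +ᶠ ∑ˡ ys
  ∑ˡ-++ []       ys = F.sym (F.+-identityˡ (∑ˡ ys))
  ∑ˡ-++ (x ∷ xs) ys = F.trans (F.+-congˡ {x} (∑ˡ-++ xs ys)) (F.sym (F.+-assoc x (∑ˡ xs) (∑ˡ ys)))

  ∑ˡ-concat-applyUpTo : ∀ (g : ℕ → List Fraction) n → ∑ˡ (concat (applyUpTo g n)) ≈ᶠ ∑ᶠ {n} (λ j → ∑ˡ (g (toℕ j)))
  ∑ˡ-concat-applyUpTo g zero    = F.refl
  ∑ˡ-concat-applyUpTo g (suc n) =
    F.trans (∑ˡ-++ (g 0) (concat (applyUpTo (g ∘ suc) n))) (F.+-congˡ {∑ˡ (g 0)} (∑ˡ-concat-applyUpTo (g ∘ suc) n))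

  ∑ˡ-↭ : ∀ {xs ys} → xs ↭ ys → ∑ˡ xs ≈ᶠ ∑ˡ ys
  ∑ˡ-↭ xs↭ys = foldr-commMonoid F.+-isCommutativeMonoid (↭⇒↭ₛ′ F.isEquivalence xs↭ys)
    where open import Data.List.Relation.Binary.Permutation.Setoid.Properties F.setoid using (foldr-commMonoid)

  ∑ˡ-map-*ʳ : ∀ {a} {A : Set a} {f g : A → Fraction} {t} xs → All (λ x → f x ≈ᶠ g x *ᶠ t) xs →
    ∑ˡ (map f xs) ≈ᶠ ∑ˡ (map g xs) *ᶠ t
  ∑ˡ-map-*ʳ {t = t} []       []       = F.sym (F.zeroˡ t)
  ∑ˡ-map-*ʳ {f = f} {g} {t} (x ∷ xs) (e ∷ es) =
    F.trans (F.+-cong {f x} {g x *ᶠ t} {∑ˡ (map f xs)} {∑ˡ (map g xs) *ᶠ t} e (∑ˡ-map-*ʳ xs es))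
            (F.sym (F.distribʳ t (g x) (∑ˡ (map g xs))))

open Defs using (_≈_)

module RegularPolynomials where

  open PolynomialRing
  open import Data.Nat as ℕ using (ℕ; zero; suc; _≤_; _<_; z≤n; s≤s)
  import Data.Nat.Properties as ℕ
  open import Data.Integer as ℤ using (ℤ; 0ℤ; 1ℤ)
  import Data.Integer.Properties as ℤ
  open import Data.Integer.Solver using (module +-*-Solver)
  open import Data.List using ([]; _∷_)
  open import Data.List.Relation.Unary.All as All using (All; []; _∷_)
  open import Data.List.Relation.Unary.All.Properties using (map⁺; applyUpTo⁺₂)
  open import Data.Product using (_,_)
  open import Relation.Nullary using (yes; no)
  open import Relation.Nullary.Negation using (contradiction)
  open import Relation.Binary.PropositionalEquality
  open ≡-Reasoning
  open import Algebra.Properties.CommutativeSemigroup ℕ.+-commutativeSemigroup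
    using () renaming (interchange to +-interchange)

  open Fractions Poly-commutativeRing using (Regular; regular-1#; regular-*)

  totalDegree : Term → ℕ
  totalDegree (_ , i , j) = i ℕ.+ j

  degreeBound : Poly → ℕ
  degreeBound []      = 0
  degreeBound (t ∷ p) = suc (totalDegree t) ℕ.+ degreeBound p

  totalDegree<degreeBound : ∀ p → All (λ t → totalDegree t < degreeBound p) p
  totalDegree<degreeBound []      = []
  totalDegree<degreeBound (t ∷ p) =
    ℕ.m≤m+n (suc (totalDegree t)) (degreeBound p)
    ∷ All.map (ℕ.m≤n⇒m≤o+n (suc (totalDegree t))) (totalDegree<degreeBound p)

  ⟪⟫-congᴬ : ∀ p {f g} → All (λ { (_ , i , j) → f i j ≡ g i j }) p → ⟪ p ⟫ f ≡ ⟪ p ⟫ g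
  ⟪⟫-congᴬ []                []          = refl
  ⟪⟫-congᴬ ((a , i , j) ∷ p) (e ∷ es) = cong₂ (λ u v → a ℤ.* u ℤ.+ v) e (⟪⟫-congᴬ p es)

  truncate : ℕ → (ℕ → ℕ → ℤ) → ℕ → ℕ → ℤ
  truncate m f i j with i ℕ.+ j ℕ.<? m
  ... | yes _ = f i j
  ... | no  _ = 0ℤ

  truncate-< : ∀ {m} f i j → i ℕ.+ j < m → truncate m f i j ≡ f i j
  truncate-< {m} f i j i+j<m with i ℕ.+ j ℕ.<? m
  ... | yes _     = refl
  ... | no  i+j≮m = contradiction i+j<m i+j≮m

  truncate-≥ : ∀ {m} f i j → m ≤ i ℕ.+ j → truncate m f i j ≡ 0ℤ
  truncate-≥ {m} f i j m≤i+j with i ℕ.+ j ℕ.<? m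
  ... | yes i+j<m = contradiction m≤i+j (ℕ.<⇒≱ i+j<m)
  ... | no  _     = refl

  ⟪⟫-truncate : ∀ q f → ⟪ q ⟫ f ≡ ⟪ q ⟫ (truncate (degreeBound q) f)
  ⟪⟫-truncate q f = ⟪⟫-congᴬ q (All.map (λ { {_ , i , j} lt → sym (truncate-< f i j lt) })
                                         (totalDegree<degreeBound q))

  HasPositiveDegree : Term → Set
  HasPositiveDegree t = 1 ≤ totalDegree t

  -- If p q = 0, then q pairs to zero with every test function vanishing in total
  -- degree ≥ m, by induction on m: the positive-degree part of p shifts such a
  -- function into one vanishing in degree ≥ m - 1, and the constant term u is
  -- invertible.  Truncating at the degree bound of q then gives q = 0.
  regular-by-constant-term : ∀ (u : ℤ) → u ℤ.* u ≡ 1ℤ → ∀ p p⁺ → All HasPositiveDegree p⁺ →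
    (∀ f → ⟪ p ⟫ f ≡ u ℤ.* f 0 0 ℤ.+ ⟪ p⁺ ⟫ f) → Regular p
  regular-by-constant-term u u²≡1 p p⁺ p⁺-positive p-split {q} pq≃0 = pairing-ext λ f →
    trans (⟪⟫-truncate q f) (vanishing (degreeBound q) _ (truncate-≥ f))
    where
    vanishing : ∀ m g → (∀ i j → m ≤ i ℕ.+ j → g i j ≡ 0ℤ) → ⟪ q ⟫ g ≡ 0ℤ
    vanishing zero    g g-vanishes = trans (⟪⟫-cong q (λ i j → g-vanishes i j z≤n)) (⟪⟫-zero q)
    vanishing (suc m) g g-vanishes = begin
      ⟪ q ⟫ g                     ≡⟨ sym (ℤ.*-identityˡ _) ⟩
      1ℤ ℤ.* ⟪ q ⟫ g              ≡⟨ cong (ℤ._* ⟪ q ⟫ g) (sym u²≡1) ⟩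
      u ℤ.* u ℤ.* ⟪ q ⟫ g         ≡⟨ ℤ.*-assoc u u _ ⟩
      u ℤ.* (u ℤ.* ⟪ q ⟫ g)       ≡⟨ cong (u ℤ.*_) u⟪q⟫≡0 ⟩
      u ℤ.* 0ℤ                    ≡⟨ ℤ.*-zeroʳ u ⟩
      0ℤ                          ∎
      where
      shifted : ∀ i j → 1 ≤ i ℕ.+ j → ⟪ q ⟫ (shift i j g) ≡ 0ℤ
      shifted i j 1≤i+j = vanishing m (shift i j g) λ k l m≤k+l → g-vanishes _ _
        (ℕ.≤-trans (ℕ.+-mono-≤ 1≤i+j m≤k+l) (ℕ.≤-reflexive (+-interchange i j k l)))
      u⟪q⟫≡0 : u ℤ.* ⟪ q ⟫ g ≡ 0ℤ
      u⟪q⟫≡0 = begin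
        u ℤ.* ⟪ q ⟫ g                                       ≡⟨ sym (ℤ.+-identityʳ _) ⟩
        u ℤ.* ⟪ q ⟫ g ℤ.+ 0ℤ                                 ≡⟨ cong (λ v → u ℤ.* ⟪ q ⟫ g ℤ.+ v) (sym p⁺-part) ⟩
        u ℤ.* ⟪ q ⟫ g ℤ.+ ⟪ p⁺ ⟫ (λ i j → ⟪ q ⟫ (shift i j g)) ≡⟨ sym (p-split _) ⟩
        ⟪ p ⟫ (λ i j → ⟪ q ⟫ (shift i j g))                  ≡⟨ sym (⟪⟫-* p q g) ⟩
        ⟪ p *P q ⟫ g                                        ≡⟨ pairing-≡ pq≃0 g ⟩
        0ℤ                                                  ∎
        where
        p⁺-part : ⟪ p⁺ ⟫ (λ i j → ⟪ q ⟫ (shift i j g)) ≡ 0ℤ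
        p⁺-part = trans (⟪⟫-congᴬ p⁺ (All.map (λ { {_ , i , j} → shifted i j }) p⁺-positive)) (⟪⟫-zero p⁺)

  regular-monomial-1 : ∀ i j → 1 ≤ i ℕ.+ j → Regular (mono i j -P 1P)
  regular-monomial-1 i j 1≤i+j =
    regular-by-constant-term (ℤ.- 1ℤ) refl (mono i j -P 1P) (mono i j) (1≤i+j ∷ []) λ f →
      solve 2 (λ x y → con 1ℤ :* x :+ (con (ℤ.- 1ℤ) :* y :+ con 0ℤ)
                    := con (ℤ.- 1ℤ) :* y :+ (con 1ℤ :* x :+ con 0ℤ)) refl (f i j) (f 0 0)
    where open +-*-Solver

  regular-qInt : ∀ n → Regular (qInt (suc n))
  regular-qInt n = regular-by-constant-term 1ℤ refl (qInt (suc n)) _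
    (map⁺ (applyUpTo⁺₂ suc n (λ _ → s≤s z≤n))) (λ f → refl)

  regular-qFact : ∀ n → Regular (qFact n)
  regular-qFact zero    = regular-1#
  regular-qFact (suc n) = regular-* {qFact n} (regular-qFact n) (regular-qInt n)

module GaussianBinomials where

  open PolynomialRing
  open import Data.Nat as ℕ using (ℕ; zero; suc; _≤_; _∸_; s≤s)
  import Data.Nat.Properties as ℕ
  open import Data.Nat.Combinatorics using (_C_; nCk+nC[k+1]≡[n+1]C[k+1]; nC1≡n)
  import Data.Nat.Solver as ℕ-Solver
  open import Data.Integer using (1ℤ)
  open import Data.Fin using (toℕ; fromℕ; inject₁)
  open import Data.Fin.Properties using (toℕ-inject₁; toℕ-fromℕ; toℕ≤pred[n])
  open import Data.List using ([]; _∷_; map; upTo)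
  open import Data.List.Properties using (map-++; upTo-∷ʳ)
  open import Data.Sum using (inj₁; inj₂)
  open import Algebra.Bundles using (CommutativeRing)
  open import Relation.Binary.PropositionalEquality as ≡ using (_≡_)

  open CommutativeRing Poly-commutativeRing
    using (setoid; semiring; reflexive; sym; trans; +-cong; +-congˡ; +-congʳ; *-cong; *-congˡ; *-congʳ;
           *-assoc; +-assoc; +-identityʳ; zeroˡ; zeroʳ)
  open import Relation.Binary.Reasoning.Setoid setoid
  open import Algebra.Properties.Semiring.Sum semiring
    using (sum; sum-syntax; sum-cong-≋; ∑-distrib-+; *-distribˡ-sum; sum-init-last)
  open PolySolver using (solve; _:+_; _:*_; _:=_; :-_; con)

  qInt-suc : ∀ n → qInt (suc n) ≡ qInt n +P mono n 0
  qInt-suc n = ≡.trans (≡.cong (map _) (≡.sym (upTo-∷ʳ n))) (map-++ _ (upTo n) (n ∷ []))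

  qInt-+ : ∀ a b → qInt a +P mono a 0 *P qInt b ≃ qInt (a ℕ.+ b)
  qInt-+ a zero = trans (+-congˡ {qInt a} (zeroʳ (mono a 0))) (trans (+-identityʳ (qInt a))
                    (reflexive (≡.cong qInt (≡.sym (ℕ.+-identityʳ a)))))
  qInt-+ a (suc b) = begin
    qInt a +P mono a 0 *P qInt (suc b)                  ≈⟨ +-congˡ {qInt a} (*-congˡ {mono a 0} (reflexive (qInt-suc b))) ⟩
    qInt a +P mono a 0 *P (qInt b +P mono b 0)          ≈⟨ solve 4 (λ p q x y → p :+ x :* (q :+ y) := (p :+ x :* q) :+ x :* y)
                                                             ≃-refl (qInt a) (qInt b) (mono a 0) (mono b 0) ⟩
    (qInt a +P mono a 0 *P qInt b) +P mono (a ℕ.+ b) 0  ≈⟨ +-congʳ {mono (a ℕ.+ b) 0} (qInt-+ a b) ⟩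
    qInt (a ℕ.+ b) +P mono (a ℕ.+ b) 0                  ≈⟨ reflexive (≡.sym (qInt-suc (a ℕ.+ b))) ⟩
    qInt (suc (a ℕ.+ b))                                ≈⟨ reflexive (≡.cong qInt (≡.sym (ℕ.+-suc a b))) ⟩
    qInt (a ℕ.+ suc b)                                  ∎

  qBinomial : ℕ → ℕ → Poly
  qBinomial k       zero    = 1P
  qBinomial zero    (suc j) = []
  qBinomial (suc k) (suc j) = qBinomial k (suc j) +P mono (k ∸ j) 0 *P qBinomial k j

  qBinomial-> : ∀ {k j} → k ℕ.< j → qBinomial k j ≃ []
  qBinomial-> {zero}  {suc j} _           = ≃-refl
  qBinomial-> {suc k} {suc j} (s≤s k<j) = begin
    qBinomial k (suc j) +P mono (k ∸ j) 0 *P qBinomial k j ≈⟨ +-cong (qBinomial-> (ℕ.m<n⇒m<1+n k<j))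
                                                                     (*-congˡ {mono (k ∸ j) 0} (qBinomial-> k<j)) ⟩
    [] +P mono (k ∸ j) 0 *P []                             ≈⟨ zeroʳ (mono (k ∸ j) 0) ⟩
    []                                                     ∎

  m∸n+1+n≡1+m : ∀ {m n} → n ≤ m → m ∸ n ℕ.+ suc n ≡ suc m
  m∸n+1+n≡1+m {m} {n} n≤m = ≡.trans (ℕ.+-suc (m ∸ n) n) (≡.cong suc (ℕ.m∸n+n≡m n≤m))

  qFact-split : ∀ {k j} → j ≤ k → qFact k ≃ (qBinomial k j *P qFact j) *P qFact (k ∸ j)

  -- For j = k both sides vanish, since [k over k+1] = 0 and [0] = 0.
  qFact-split-first : ∀ {k j} → j ≤ k →
    (qBinomial k (suc j) *P qFact (suc j)) *P qFact (k ∸ j) ≃ qFact k *P qInt (k ∸ j)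
  qFact-split-first {k} {j} j≤k with ℕ.m≤n⇒m<n∨m≡n j≤k
  ... | inj₁ j<k = begin
    ([k,j+1] *P qFact (suc j)) *P qFact (k ∸ j)
      ≈⟨ *-congˡ {[k,j+1] *P qFact (suc j)} (reflexive (≡.cong qFact (ℕ.+-∸-assoc 1 j<k))) ⟩
    ([k,j+1] *P qFact (suc j)) *P (qFact (k ∸ suc j) *P qInt (suc (k ∸ suc j)))
      ≈⟨ *-assoc ([k,j+1] *P qFact (suc j)) (qFact (k ∸ suc j)) (qInt (suc (k ∸ suc j))) ⟨
    (([k,j+1] *P qFact (suc j)) *P qFact (k ∸ suc j)) *P qInt (suc (k ∸ suc j))
      ≈⟨ *-cong (sym (qFact-split j<k)) (reflexive (≡.cong qInt (≡.sym (ℕ.+-∸-assoc 1 j<k)))) ⟩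
    qFact k *P qInt (k ∸ j) ∎
    where [k,j+1] = qBinomial k (suc j)
  ... | inj₂ ≡.refl = begin
    (qBinomial k (suc k) *P qFact (suc k)) *P qFact (k ∸ k) ≈⟨ *-congʳ {qFact (k ∸ k)} (*-congʳ {qFact (suc k)} (qBinomial-> (ℕ.n<1+n k))) ⟩
    ([] *P qFact (suc k)) *P qFact (k ∸ k)                  ≈⟨ trans (*-congʳ {qFact (k ∸ k)} (zeroˡ (qFact (suc k)))) (zeroˡ (qFact (k ∸ k))) ⟩
    []                                                     ≈⟨ zeroʳ (qFact k) ⟨
    qFact k *P []                                          ≈⟨ *-congˡ {qFact k} (reflexive (≡.cong qInt (ℕ.n∸n≡0 k))) ⟨
    qFact k *P qInt (k ∸ k)                                ∎

  qFact-split {k} {zero} _ = solve 1 (λ F → F := (con 1ℤ :* con 1ℤ) :* F) ≃-refl (qFact k)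
  qFact-split {suc k} {suc j} (s≤s j≤k) = sym (begin
    (([k,j+1] +P xᵏ⁻ʲ *P [k,j]) *P ([j]! *P [j+1])) *P [k-j]!
      ≈⟨ solve 6 (λ A B M Fj I Fd → ((A :+ M :* B) :* (Fj :* I)) :* Fd := (A :* (Fj :* I)) :* Fd :+ ((B :* Fj) :* Fd) :* (M :* I))
           ≃-refl [k,j+1] [k,j] xᵏ⁻ʲ [j]! [j+1] [k-j]! ⟩
    ([k,j+1] *P ([j]! *P [j+1])) *P [k-j]! +P (([k,j] *P [j]!) *P [k-j]!) *P (xᵏ⁻ʲ *P [j+1])
      ≈⟨ +-cong (qFact-split-first j≤k) (*-congʳ {xᵏ⁻ʲ *P [j+1]} (sym (qFact-split j≤k))) ⟩
    qFact k *P [k-j] +P qFact k *P (xᵏ⁻ʲ *P [j+1])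
      ≈⟨ solve 3 (λ F A B → F :* A :+ F :* B := F :* (A :+ B)) ≃-refl (qFact k) [k-j] (xᵏ⁻ʲ *P [j+1]) ⟩
    qFact k *P ([k-j] +P xᵏ⁻ʲ *P [j+1])
      ≈⟨ *-congˡ {qFact k} (trans (qInt-+ (k ∸ j) (suc j)) (reflexive (≡.cong qInt (m∸n+1+n≡1+m j≤k)))) ⟩
    qFact k *P qInt (suc k) ∎)
    where
    [k,j+1] = qBinomial k (suc j)
    [k,j]   = qBinomial k j
    xᵏ⁻ʲ    = mono (k ∸ j) 0
    [j]!    = qFact j
    [j+1]   = qInt (suc j)
    [k-j]!  = qFact (k ∸ j)
    [k-j]   = qInt (k ∸ j)


  Y : ℕ → Poly
  Y n = mono n 1 -P 1P

  YProduct : ℕ → ℕ → Poly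
  YProduct s zero    = 1P
  YProduct s (suc j) = YProduct s j *P Y (suc (s ℕ.+ j))

  qBinomialTerm : ℕ → ℕ → ℕ → Poly
  qBinomialTerm k m j = (mono (j C 2) 0 *P qBinomial k j) *P YProduct (k ∸ j ℕ.+ m) j

  private
    suc-C2 : ∀ j → suc j C 2 ≡ j ℕ.+ j C 2
    suc-C2 j = ≡.trans (≡.sym (nCk+nC[k+1]≡[n+1]C[k+1] j 1)) (≡.cong (ℕ._+ j C 2) (nC1≡n j))

    open ℕ-Solver.+-*-Solver using () renaming (solve to ℕ-solve; _:+_ to _⊕_; _:*_ to _⊗_; _:=_ to _⊜_; con to ℕ-con)

    exponent-shift : ∀ k m → k ℕ.* k ℕ.+ k ℕ.* suc m ≡ k ℕ.+ (k ℕ.* k ℕ.+ k ℕ.* m)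
    exponent-shift = ℕ-solve 2 (λ k m → k ⊗ k ⊕ k ⊗ (ℕ-con 1 ⊕ m) ⊜ k ⊕ (k ⊗ k ⊕ k ⊗ m)) ≡.refl

    exponent-step : ∀ k m → k ℕ.+ (suc k ℕ.+ m) ℕ.+ (k ℕ.* k ℕ.+ k ℕ.* m) ≡ suc k ℕ.* suc k ℕ.+ suc k ℕ.* m
    exponent-step = ℕ-solve 2 (λ k m → k ⊕ ((ℕ-con 1 ⊕ k) ⊕ m) ⊕ (k ⊗ k ⊕ k ⊗ m)
                                     ⊜ (ℕ-con 1 ⊕ k) ⊗ (ℕ-con 1 ⊕ k) ⊕ (ℕ-con 1 ⊕ k) ⊗ m) ≡.refl

    exponent-C2 : ∀ {j k} → j ≤ k → suc j C 2 ℕ.+ (k ∸ j) ≡ k ℕ.+ j C 2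
    exponent-C2 {j} {k} j≤k = ≡.trans (≡.cong (ℕ._+ (k ∸ j)) (suc-C2 j))
      (≡.trans (ℕ-solve 3 (λ j c d → j ⊕ c ⊕ d ⊜ (d ⊕ j) ⊕ c) ≡.refl j (j C 2) (k ∸ j))
               (≡.cong (ℕ._+ j C 2) (ℕ.m∸n+n≡m j≤k)))

  -- The q-analogue of ∑ⱼ (k choose j) (z - 1)ʲ = zᵏ, with z = xᵐ y.
  q-binomial-theorem : ∀ k m → ∑[ j < suc k ] qBinomialTerm k m (toℕ j) ≃ mono (k ℕ.* k ℕ.+ k ℕ.* m) k
  q-binomial-theorem zero m = trans (+-identityʳ _) (solve 0 ((con 1ℤ :* con 1ℤ) :* con 1ℤ := con 1ℤ) ≃-refl)
  q-binomial-theorem (suc k) m = begin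
    qBinomialTerm (suc k) m 0 +P ∑[ j < suc k ] qBinomialTerm (suc k) m (suc (toℕ j))
      ≈⟨ +-congˡ {qBinomialTerm (suc k) m 0} (trans
           (sum-cong-≋ {suc k} {x = λ j → qBinomialTerm (suc k) m (suc (toℕ j))} {λ j → U (toℕ j) +P V (toℕ j)}
                       (λ j → pascal (toℕ j)))
           (∑-distrib-+ {suc k} (λ j → U (toℕ j)) (λ j → V (toℕ j)))) ⟩
    qBinomialTerm (suc k) m 0 +P (∑[ j < suc k ] U (toℕ j) +P ∑[ j < suc k ] V (toℕ j))
      ≈⟨ +-assoc (qBinomialTerm (suc k) m 0) (∑[ j < suc k ] U (toℕ j)) (∑[ j < suc k ] V (toℕ j)) ⟨
    ∑[ j < suc (suc k) ] g (toℕ j) +P ∑[ j < suc k ] V (toℕ j)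
      ≈⟨ +-cong new-parts old-parts ⟩
    mono (k ℕ.* k ℕ.+ k ℕ.* suc m) k +P (mono k 0 *P Y (suc (k ℕ.+ m))) *P xᴱyᵏ
      ≈⟨ +-congʳ {(mono k 0 *P Y (suc (k ℕ.+ m))) *P xᴱyᵏ} (reflexive (≡.cong₂ mono (exponent-shift k m) ≡.refl)) ⟩
    mono k 0 *P xᴱyᵏ +P (mono k 0 *P (mono (suc k ℕ.+ m) 1 -P 1P)) *P xᴱyᵏ
      ≈⟨ solve 3 (λ M A B → M :* A :+ (M :* (B :+ (:- con 1ℤ))) :* A := (M :* B) :* A) ≃-refl
           (mono k 0) xᴱyᵏ (mono (suc k ℕ.+ m) 1) ⟩
    (mono k 0 *P mono (suc k ℕ.+ m) 1) *P xᴱyᵏ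
      ≈⟨ reflexive (≡.cong₂ mono (exponent-step k m) ≡.refl) ⟩
    mono (suc k ℕ.* suc k ℕ.+ suc k ℕ.* m) (suc k) ∎
    where
    E = k ℕ.* k ℕ.+ k ℕ.* m
    xᴱyᵏ = mono E k
    g U V : ℕ → Poly
    g j = (mono (j C 2) 0 *P qBinomial k j) *P YProduct (suc k ∸ j ℕ.+ m) j
    U j = g (suc j)
    V j = (mono (suc j C 2) 0 *P (mono (k ∸ j) 0 *P qBinomial k j)) *P YProduct (k ∸ j ℕ.+ m) (suc j)

    pascal : ∀ j → qBinomialTerm (suc k) m (suc j) ≃ U j +P V j
    pascal j = solve 4 (λ c a b r → (c :* (a :+ b)) :* r := (c :* a) :* r :+ (c :* b) :* r) ≃-refl
      (mono (suc j C 2) 0) (qBinomial k (suc j)) (mono (k ∸ j) 0 *P qBinomial k j) (YProduct (k ∸ j ℕ.+ m) (suc j))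

    g≃shifted-term : ∀ {j} → j ≤ k → g j ≃ qBinomialTerm k (suc m) j
    g≃shifted-term {j} j≤k = *-congˡ {mono (j C 2) 0 *P qBinomial k j}
      (reflexive (≡.cong (λ s → YProduct s j) (≡.trans (≡.cong (ℕ._+ m) (ℕ.+-∸-assoc 1 j≤k)) (≡.sym (ℕ.+-suc (k ∸ j) m)))))

    g-last : g (suc k) ≃ []
    g-last = begin
      (mono (suc k C 2) 0 *P qBinomial k (suc k)) *P Ψ   ≈⟨ *-congʳ {Ψ} (*-congˡ {mono (suc k C 2) 0} (qBinomial-> (ℕ.n<1+n k))) ⟩
      (mono (suc k C 2) 0 *P []) *P Ψ                    ≈⟨ trans (*-congʳ {Ψ} (zeroʳ (mono (suc k C 2) 0))) (zeroˡ Ψ) ⟩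
      []                                                 ∎
      where Ψ = YProduct (suc k ∸ suc k ℕ.+ m) (suc k)

    new-parts : ∑[ j < suc (suc k) ] g (toℕ j) ≃ mono (k ℕ.* k ℕ.+ k ℕ.* suc m) k
    new-parts = begin
      ∑[ j < suc (suc k) ] g (toℕ j)
        ≈⟨ sum-init-last (λ j → g (toℕ j)) ⟩
      ∑[ j < suc k ] g (toℕ (inject₁ j)) +P g (toℕ (fromℕ (suc k)))
        ≈⟨ +-cong (sum-cong-≋ {suc k} {x = λ j → g (toℕ (inject₁ j))} {λ j → qBinomialTerm k (suc m) (toℕ j)} λ j →
                     trans (reflexive (≡.cong g (toℕ-inject₁ j))) (g≃shifted-term (toℕ≤pred[n] j)))
                  (trans (reflexive (≡.cong g (toℕ-fromℕ (suc k)))) g-last) ⟩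
      ∑[ j < suc k ] qBinomialTerm k (suc m) (toℕ j) +P []
        ≈⟨ trans (+-identityʳ _) (q-binomial-theorem k (suc m)) ⟩
      mono (k ℕ.* k ℕ.+ k ℕ.* suc m) k ∎

    V≃term : ∀ {j} → j ≤ k → V j ≃ (mono k 0 *P Y (suc (k ℕ.+ m))) *P qBinomialTerm k m j
    V≃term {j} j≤k = begin
      (x^C[j+1,2] *P (xᵏ⁻ʲ *P [k,j])) *P (Ψ *P Y (suc (k ∸ j ℕ.+ m ℕ.+ j)))
        ≈⟨ solve 5 (λ c d q r y → (c :* (d :* q)) :* (r :* y) := ((c :* d) :* y) :* (q :* r)) ≃-refl
             x^C[j+1,2] xᵏ⁻ʲ [k,j] Ψ (Y (suc (k ∸ j ℕ.+ m ℕ.+ j))) ⟩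
      ((x^C[j+1,2] *P xᵏ⁻ʲ) *P Y (suc (k ∸ j ℕ.+ m ℕ.+ j))) *P ([k,j] *P Ψ)
        ≈⟨ *-congʳ {[k,j] *P Ψ} (*-cong (reflexive (≡.cong₂ mono (exponent-C2 j≤k) ≡.refl))
                                         (reflexive (≡.cong (λ n → Y (suc n)) Y-index))) ⟩
      ((mono k 0 *P x^C[j,2]) *P Y (suc (k ℕ.+ m))) *P ([k,j] *P Ψ)
        ≈⟨ solve 5 (λ a c y q r → ((a :* c) :* y) :* (q :* r) := (a :* y) :* ((c :* q) :* r)) ≃-refl
             (mono k 0) x^C[j,2] (Y (suc (k ℕ.+ m))) [k,j] Ψ ⟩
      (mono k 0 *P Y (suc (k ℕ.+ m))) *P qBinomialTerm k m j ∎
      where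
      x^C[j+1,2] = mono (suc j C 2) 0
      x^C[j,2]   = mono (j C 2) 0
      xᵏ⁻ʲ       = mono (k ∸ j) 0
      [k,j]      = qBinomial k j
      Ψ          = YProduct (k ∸ j ℕ.+ m) j
      Y-index : k ∸ j ℕ.+ m ℕ.+ j ≡ k ℕ.+ m
      Y-index = ≡.trans (ℕ.+-assoc (k ∸ j) m j) (≡.trans (≡.cong (k ∸ j ℕ.+_) (ℕ.+-comm m j))
                  (≡.trans (≡.sym (ℕ.+-assoc (k ∸ j) j m)) (≡.cong (ℕ._+ m) (ℕ.m∸n+n≡m j≤k))))

    old-parts : ∑[ j < suc k ] V (toℕ j) ≃ (mono k 0 *P Y (suc (k ℕ.+ m))) *P xᴱyᵏ
    old-parts = begin
      ∑[ j < suc k ] V (toℕ j)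
        ≈⟨ sum-cong-≋ {suc k} {x = λ j → V (toℕ j)} {λ j → (mono k 0 *P Y (suc (k ℕ.+ m))) *P qBinomialTerm k m (toℕ j)}
                      (λ j → V≃term (toℕ≤pred[n] j)) ⟩
      ∑[ j < suc k ] ((mono k 0 *P Y (suc (k ℕ.+ m))) *P qBinomialTerm k m (toℕ j))
        ≈⟨ *-distribˡ-sum {suc k} (mono k 0 *P Y (suc (k ℕ.+ m))) (λ j → qBinomialTerm k m (toℕ j)) ⟨
      (mono k 0 *P Y (suc (k ℕ.+ m))) *P ∑[ j < suc k ] qBinomialTerm k m (toℕ j)
        ≈⟨ *-congˡ {mono k 0 *P Y (suc (k ℕ.+ m))} (q-binomial-theorem k m) ⟩
      (mono k 0 *P Y (suc (k ℕ.+ m))) *P xᴱyᵏ ∎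

module ClosedForm where

  open PolynomialRing
  open RegularPolynomials
  open GaussianBinomials
  open import Data.Nat as ℕ using (ℕ; zero; suc; _≤_; _∸_; s≤s; z≤n)
  import Data.Nat.Properties as ℕ
  open import Data.Nat.Combinatorics using (_C_)
  open import Data.Integer using (1ℤ)
  open import Data.Fin using (toℕ)
  open import Data.Fin.Properties using (toℕ≤pred[n])
  open import Algebra.Bundles using (CommutativeRing)
  import Algebra.Properties.Semiring.Sum
  open import Relation.Binary.PropositionalEquality as ≡ using (_≡_)

  open Fractions Poly-commutativeRing
  open CommutativeRing Poly-commutativeRing
    using (reflexive; sym; trans; *-congˡ; *-congʳ; *-identityʳ)
  open PolySolver using (solve; _:+_; _:*_; _:=_; :-_; con)

  module ∑ᴾ = Algebra.Properties.Semiring.Sum (CommutativeRing.semiring Poly-commutativeRing)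

  toRatFun : Fraction → RatFun
  toRatFun x = numerator x / denominator x

  ⟦_∣_⟧ : (r : RatFun) → Regular (den r) → Fraction
  ⟦ r ∣ reg ⟧ = frac (num r) (den r) reg

  ≈ᶠ⇒≈ : ∀ {x y} → x ≈ᶠ y → toRatFun x ≈ toRatFun y
  ≈ᶠ⇒≈ (cross e) = ≃⇒≈P e

  X : ℕ → Poly
  X n = mono (n ℕ.* n) n -P 1P

  regular-X : ∀ {n} → 1 ≤ n → Regular (X n)
  regular-X {n} 1≤n = regular-monomial-1 (n ℕ.* n) n (ℕ.m≤n⇒m≤o+n (n ℕ.* n) 1≤n)

  num-rhsProd : ∀ n → num (rhsProd n) ≃ 1P
  num-rhsProd zero    = ≃-refl
  num-rhsProd (suc n) = trans (*-identityʳ (num (rhsProd n))) (num-rhsProd n)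

  regular-den-rhsProd : ∀ n → Regular (den (rhsProd n))
  regular-den-rhsProd zero    = regular-1#
  regular-den-rhsProd (suc n) =
    regular-* {den (rhsProd n)} {Y (suc n)} (regular-den-rhsProd n) (regular-monomial-1 (suc n) 1 (s≤s z≤n))

  den-rhsProd-+ : ∀ a j → den (rhsProd (a ℕ.+ j)) ≃ den (rhsProd a) *P YProduct a j
  den-rhsProd-+ a zero    = trans (reflexive (≡.cong (λ m → den (rhsProd m)) (ℕ.+-identityʳ a))) (sym (*-identityʳ _))
  den-rhsProd-+ a (suc j) = begin
    den (rhsProd (a ℕ.+ suc j))                            ≡⟨ ≡.cong (λ n → den (rhsProd n)) (ℕ.+-suc a j) ⟩
    den (rhsProd (a ℕ.+ j)) *P Y (suc (a ℕ.+ j))           ≈⟨ *-congʳ {Y (suc (a ℕ.+ j))} (den-rhsProd-+ a j) ⟩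
    (den (rhsProd a) *P YProduct a j) *P Y (suc (a ℕ.+ j)) ≈⟨ *-assoc (den (rhsProd a)) (YProduct a j) _ ⟩
    den (rhsProd a) *P YProduct a (suc j)                  ∎
    where
    open CommutativeRing Poly-commutativeRing using (setoid; *-assoc)
    open import Relation.Binary.Reasoning.Setoid setoid

  closedFormᶠ : ℕ → Fraction
  closedFormᶠ n = ⟦ inv (qFact n) *F rhsProd n ∣ regular-* {qFact n} (regular-qFact n) (regular-den-rhsProd n) ⟧

  partFactor : ℕ → ℕ → RatFun
  partFactor n c = inv (X n) *F (mono (c C 2) 0 / qFact c)

  regular-partFactor : ∀ {n} c → 1 ≤ n → Regular (den (partFactor n c))
  regular-partFactor {n} c 1≤n = regular-* {X n} {qFact c} (regular-X 1≤n) (regular-qFact c)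

  -- At partial sum 0 the denominator x⁰y⁰ - 1 vanishes; this junk case never
  -- occurs for a composition.
  partFactorᶠ : ℕ → ℕ → Fraction
  partFactorᶠ zero    c = 0ᶠ
  partFactorᶠ (suc n) c = ⟦ partFactor (suc n) c ∣ regular-partFactor c (s≤s z≤n) ⟧

  commonDenominator : ℕ → Poly
  commonDenominator n = (X n *P qFact n) *P den (rhsProd n)

  regular-commonDenominator : ∀ {n} → 1 ≤ n → Regular (commonDenominator n)
  regular-commonDenominator {n} 1≤n =
    regular-* {X n *P qFact n} (regular-partFactor n 1≤n) (regular-den-rhsProd n)

  closedForm*partFactor : ∀ {k j} → j ≤ k →
    closedFormᶠ (k ∸ j) *ᶠ partFactorᶠ (suc k) (suc j)
      ≈ᶠ frac (qBinomialTerm (suc k) 0 (suc j)) (commonDenominator (suc k)) (regular-commonDenominator {suc k} (s≤s z≤n))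
  closedForm*partFactor {k} {j} j≤k = cross (begin
    ((1P *P num (rhsProd a)) *P (1P *P xᶜ)) *P ((X n *P qFact n) *P den (rhsProd n))
      ≈⟨ *-cong (*-congʳ {1P *P xᶜ} (*-congˡ {1P} (num-rhsProd a)))
                (*-cong (*-congˡ {X n} (qFact-split (s≤s j≤k))) den-split) ⟩
    ((1P *P 1P) *P (1P *P xᶜ)) *P ((X n *P (([n,c] *P qFact c) *P qFact a)) *P (den (rhsProd a) *P Ψ))
      ≈⟨ solve 7 (λ x q Fc Fa P Ψ Xn → ((con 1ℤ :* con 1ℤ) :* (con 1ℤ :* x)) :* ((Xn :* ((q :* Fc) :* Fa)) :* (P :* Ψ))
                                    := ((x :* q) :* Ψ) :* ((Fa :* P) :* (Xn :* Fc))) ≃-refl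
           xᶜ [n,c] (qFact c) (qFact a) (den (rhsProd a)) Ψ (X n) ⟩
    ((xᶜ *P [n,c]) *P Ψ) *P ((qFact a *P den (rhsProd a)) *P (X n *P qFact c))
      ≈⟨ *-congʳ {(qFact a *P den (rhsProd a)) *P (X n *P qFact c)}
           (*-congˡ {xᶜ *P [n,c]} (reflexive (≡.cong (λ s → YProduct s c) (≡.sym (ℕ.+-identityʳ a))))) ⟩
    ((xᶜ *P [n,c]) *P YProduct (a ℕ.+ 0) c) *P ((qFact a *P den (rhsProd a)) *P (X n *P qFact c)) ∎)
    where
    open CommutativeRing Poly-commutativeRing using (setoid; *-cong)
    open import Relation.Binary.Reasoning.Setoid setoid
    n = suc k
    c = suc j
    a = k ∸ j
    xᶜ = mono (c C 2) 0
    [n,c] = qBinomial n c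
    Ψ = YProduct a c
    den-split : den (rhsProd n) ≃ den (rhsProd a) *P Ψ
    den-split = trans (reflexive (≡.cong (λ m → den (rhsProd m)) (≡.sym (m∸n+1+n≡1+m j≤k)))) (den-rhsProd-+ a c)

  ∑qBinomialTerm≃X : ∀ n → ∑ᴾ.sum {n} (λ j → qBinomialTerm n 0 (suc (toℕ j))) ≃ X n
  ∑qBinomialTerm≃X n = begin
    S                                         ≈⟨ solve 2 (λ t S → S := (t :+ S) :+ (:- t)) ≃-refl (qBinomialTerm n 0 0) S ⟩
    (qBinomialTerm n 0 0 +P S) +P -P qBinomialTerm n 0 0
                                              ≈⟨ +-cong (q-binomial-theorem n 0) (-‿cong first-term) ⟩
    mono (n ℕ.* n ℕ.+ n ℕ.* 0) n +P -P 1P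
                                              ≡⟨ ≡.cong (λ e → mono e n -P 1P)
                                                   (≡.trans (≡.cong (n ℕ.* n ℕ.+_) (ℕ.*-zeroʳ n)) (ℕ.+-identityʳ _)) ⟩
    X n                                       ∎
    where
    open CommutativeRing Poly-commutativeRing using (setoid; +-cong; -‿cong)
    open import Relation.Binary.Reasoning.Setoid setoid
    S = ∑ᴾ.sum {n} (λ j → qBinomialTerm n 0 (suc (toℕ j)))
    first-term : qBinomialTerm n 0 0 ≃ 1P
    first-term = solve 0 ((con 1ℤ :* con 1ℤ) :* con 1ℤ := con 1ℤ) ≃-refl

  -- Clearing the common denominator turns the recurrence into the q-binomial theorem.
  closedForm-recurrence : ∀ k →
    ∑ᶠ {suc k} (λ j → closedFormᶠ (k ∸ toℕ j) *ᶠ partFactorᶠ (suc k) (suc (toℕ j))) ≈ᶠ closedFormᶠ (suc k)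
  closedForm-recurrence k = begin
    ∑ᶠ {n} (λ j → closedFormᶠ (k ∸ toℕ j) *ᶠ partFactorᶠ n (suc (toℕ j)))
      ≈⟨ ∑ᶠ-cong (λ j → closedForm*partFactor {k} {toℕ j} (toℕ≤pred[n] j)) ⟩
    ∑ᶠ {n} (λ j → frac (qBinomialTerm n 0 (suc (toℕ j))) D regular-D)
      ≈⟨ ∑-common-denominator {n} (λ j → qBinomialTerm n 0 (suc (toℕ j))) D regular-D ⟩
    frac (∑ᴾ.sum {n} (λ j → qBinomialTerm n 0 (suc (toℕ j)))) D regular-D
      ≈⟨ cross (*-congʳ {D} (∑qBinomialTerm≃X n)) ⟩
    frac (X n) D regular-D
      ≈⟨ cross (trans (solve 3 (λ x f p → x :* (f :* p) := (con 1ℤ :* con 1ℤ) :* ((x :* f) :* p)) ≃-refl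
                          (X n) (qFact n) (den (rhsProd n)))
                      (*-congʳ {D} (*-congˡ {1P} (sym (num-rhsProd n))))) ⟩
    closedFormᶠ n ∎
    where
    open import Relation.Binary.Reasoning.Setoid (CommutativeRing.setoid Fraction-commutativeRing)
    n = suc k
    D = commonDenominator n
    regular-D = regular-commonDenominator {n} (s≤s z≤n)

module Compositions where

  open GaussianBinomials using (m∸n+1+n≡1+m)
  open import Data.Nat as ℕ using (ℕ; zero; suc; _≤_; _<_; _∸_; s≤s; z≤n)
  import Data.Nat.Properties as ℕ
  open import Data.Nat.ListAction using (sum)
  open import Data.Nat.ListAction.Properties using (sum-++)
  open import Data.List using (List; []; _∷_; _∷ʳ_; map; concat; applyUpTo; initLast; _∷ʳ′_)
  open import Data.List.Properties using (∷ʳ-injective; ∷ʳ-injectiveˡ)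
  open import Data.List.Relation.Unary.All using (All; []; _∷_)
  open import Data.List.Relation.Unary.All.Properties using (∷ʳ⁺; ∷ʳ⁻; applyUpTo⁺₂)
  open import Data.List.Relation.Unary.AllPairs using ([]; _∷_)
  open import Data.List.Relation.Unary.AllPairs.Properties using (applyUpTo⁺₁)
  open import Data.List.Relation.Unary.Any using (here)
  open import Data.List.Membership.Propositional using (_∈_)
  open import Data.List.Membership.Propositional.Properties
    using (∈-map⁺; ∈-map⁻; ∈-concat⁺′; ∈-concat⁻′; ∈-applyUpTo⁺; ∈-applyUpTo⁻)
  open import Data.List.Relation.Unary.Unique.Propositional using (Unique)
  import Data.List.Relation.Unary.Unique.Propositional.Properties as Unique
  open import Data.Product using (_×_; _,_; proj₂)
  open import Data.List.Relation.Binary.Disjoint.Propositional using (Disjoint)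
  open import Relation.Binary.PropositionalEquality as ≡ using (_≡_)

  IsComposition : ℕ → List ℕ → Set
  IsComposition n c = All (1 ≤_) c × sum c ≡ n

  sum-∷ʳ : ∀ c x → sum (c ∷ʳ x) ≡ sum c ℕ.+ x
  sum-∷ʳ c x = ≡.trans (sum-++ c (x ∷ [])) (≡.cong (sum c ℕ.+_) (ℕ.+-identityʳ x))

  -- The fuel f ≥ n only makes the recursion structural.
  compositionsWithin : (f n : ℕ) → List (List ℕ)
  withLastPart : (f n j : ℕ) → List (List ℕ)

  compositionsWithin _       zero    = [] ∷ []
  compositionsWithin zero    (suc n) = []
  compositionsWithin (suc f) (suc n) = concat (applyUpTo (withLastPart f n) (suc n))

  withLastPart f n j = map (_∷ʳ suc j) (compositionsWithin f (n ∸ j))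

  compositionsWithin-sound : ∀ f n {c} → c ∈ compositionsWithin f n → IsComposition n c
  compositionsWithin-sound _       zero    (here ≡.refl) = [] , ≡.refl
  compositionsWithin-sound (suc f) (suc n) c∈
    with xs , c∈xs , xs∈ ← ∈-concat⁻′ (applyUpTo (withLastPart f n) (suc n)) c∈
    with j , j<1+n , ≡.refl ← ∈-applyUpTo⁻ (withLastPart f n) xs∈
    with c′ , c′∈ , ≡.refl ← ∈-map⁻ (_∷ʳ suc j) c∈xs
    with pos , sum≡n∸j ← compositionsWithin-sound f (n ∸ j) c′∈
    = ∷ʳ⁺ pos (s≤s z≤n)
    , ≡.trans (sum-∷ʳ c′ (suc j)) (≡.trans (≡.cong (ℕ._+ suc j) sum≡n∸j) (m∸n+1+n≡1+m (ℕ.≤-pred j<1+n)))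

  compositionsWithin-complete : ∀ {f n c} → n ≤ f → IsComposition n c → c ∈ compositionsWithin f n
  compositionsWithin-complete {c = c} n≤f (pos , sum≡n) with initLast c
  compositionsWithin-complete n≤f (pos , ≡.refl) | [] = here ≡.refl
  compositionsWithin-complete n≤f (pos , sum≡n) | c′ ∷ʳ′ x with ∷ʳ⁻ pos
  ... | pos′ , s≤s {n = j} z≤n rewrite sum-∷ʳ c′ (suc j) | ℕ.+-suc (sum c′) j with sum≡n | n≤f
  ... | ≡.refl | s≤s m≤f =
    ∈-concat⁺′ (∈-map⁺ (_∷ʳ suc j) IH) (∈-applyUpTo⁺ (withLastPart _ (sum c′ ℕ.+ j)) (s≤s (ℕ.m≤n+m j (sum c′))))
    where
    IH = compositionsWithin-complete (ℕ.≤-trans (ℕ.m∸n≤m (sum c′ ℕ.+ j) j) m≤f)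
                                     (pos′ , ≡.sym (ℕ.m+n∸n≡m (sum c′) j))

  compositionsWithin-unique : ∀ f n → Unique (compositionsWithin f n)
  compositionsWithin-unique _       zero    = [] ∷ []
  compositionsWithin-unique zero    (suc n) = []
  compositionsWithin-unique (suc f) (suc n) = Unique.concat⁺
    (applyUpTo⁺₂ (withLastPart f n) (suc n) λ j →
      Unique.map⁺ (λ {x} {y} → ∷ʳ-injectiveˡ x y) (compositionsWithin-unique f (n ∸ j)))
    (applyUpTo⁺₁ (withLastPart f n) (suc n) λ i<j _ → distinct-last-parts i<j)
    where
    distinct-last-parts : ∀ {i j} → i < j → Disjoint (withLastPart f n i) (withLastPart f n j)
    distinct-last-parts i<j (v∈i , v∈j)
      with _ , _ , ≡.refl ← ∈-map⁻ _ v∈i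
      with _ , _ , e ← ∈-map⁻ _ v∈j
      = ℕ.<⇒≢ i<j (ℕ.suc-injective (proj₂ (∷ʳ-injective _ _ e)))

module CompositionSums where

  open PolynomialRing
  open GaussianBinomials using (m∸n+1+n≡1+m)
  open ClosedForm
  open Compositions
  open import Data.Nat as ℕ using (ℕ; zero; suc; _≤_; _∸_; s≤s; z≤n)
  import Data.Nat.Properties as ℕ
  open import Data.Nat.ListAction using (sum)
  open import Data.Fin using (toℕ)
  open import Data.Fin.Properties using (toℕ≤pred[n])
  open import Data.List using (List; []; _∷_; _∷ʳ_; map; concat; applyUpTo)
  open import Data.List.Properties using (map-∘; concat-map; map-applyUpTo)
  open import Data.List.Relation.Unary.All as All using (All; []; _∷_)
  open import Data.Product using (_,_)
  open import Function using (_∘_)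
  open import Algebra.Bundles using (CommutativeRing)
  open import Relation.Binary.PropositionalEquality as ≡ using (_≡_)

  open Fractions Poly-commutativeRing
  private module Fr = CommutativeRing Fraction-commutativeRing
  open import Relation.Binary.Reasoning.Setoid Fr.setoid

  ΠFromᶠ : ℕ → List ℕ → Fraction
  ΠFromᶠ b []       = 1ᶠ
  ΠFromᶠ b (c ∷ cs) = partFactorᶠ (b ℕ.+ c) c *ᶠ ΠFromᶠ (b ℕ.+ c) cs

  Πᶠ : List ℕ → Fraction
  Πᶠ = ΠFromᶠ 0

  toRatFun-+ᶠ : ∀ x y → toRatFun (x +ᶠ y) ≡ toRatFun x +F toRatFun y
  toRatFun-+ᶠ (frac _ _ _) (frac _ _ _) = ≡.refl

  toRatFun-*ᶠ : ∀ x y → toRatFun (x *ᶠ y) ≡ toRatFun x *F toRatFun y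
  toRatFun-*ᶠ (frac _ _ _) (frac _ _ _) = ≡.refl

  toRatFun-ΠFromᶠ : ∀ b {cs} → All (1 ≤_) cs → toRatFun (ΠFromᶠ b cs) ≡ ΠFrom b cs
  toRatFun-ΠFromᶠ b []                    = ≡.refl
  toRatFun-ΠFromᶠ b {c ∷ cs} (1≤c ∷ pos) =
    ≡.trans (toRatFun-*ᶠ (partFactorᶠ (b ℕ.+ c) c) (ΠFromᶠ (b ℕ.+ c) cs))
            (≡.cong₂ _*F_ (partFactor-positive (ℕ.≤-trans 1≤c (ℕ.m≤n+m c b))) (toRatFun-ΠFromᶠ (b ℕ.+ c) pos))
    where
    partFactor-positive : ∀ {n} → 1 ≤ n → toRatFun (partFactorᶠ n c) ≡ partFactor n c
    partFactor-positive (s≤s z≤n) = ≡.refl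

  toRatFun-∑Π : ∀ L → All (All (1 ≤_)) L → toRatFun (∑ˡ (map Πᶠ L)) ≡ sumF (map Π L)
  toRatFun-∑Π []      []            = ≡.refl
  toRatFun-∑Π (c ∷ L) (pos ∷ L-pos) =
    ≡.trans (toRatFun-+ᶠ (Πᶠ c) (∑ˡ (map Πᶠ L))) (≡.cong₂ _+F_ (toRatFun-ΠFromᶠ 0 pos) (toRatFun-∑Π L L-pos))

  ΠFromᶠ-∷ʳ : ∀ b cs c → ΠFromᶠ b (cs ∷ʳ c) ≈ᶠ ΠFromᶠ b cs *ᶠ partFactorᶠ (b ℕ.+ sum cs ℕ.+ c) c
  ΠFromᶠ-∷ʳ b [] c = begin
    partFactorᶠ (b ℕ.+ c) c *ᶠ 1ᶠ   ≈⟨ Fr.*-comm (partFactorᶠ (b ℕ.+ c) c) 1ᶠ ⟩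
    1ᶠ *ᶠ partFactorᶠ (b ℕ.+ c) c   ≡⟨ ≡.cong (λ m → 1ᶠ *ᶠ partFactorᶠ (m ℕ.+ c) c) (≡.sym (ℕ.+-identityʳ b)) ⟩
    1ᶠ *ᶠ partFactorᶠ (b ℕ.+ 0 ℕ.+ c) c ∎
  ΠFromᶠ-∷ʳ b (c₀ ∷ cs) c = begin
    P₀ *ᶠ ΠFromᶠ b′ (cs ∷ʳ c)                          ≈⟨ Fr.*-congˡ {P₀} (ΠFromᶠ-∷ʳ b′ cs c) ⟩
    P₀ *ᶠ (ΠFromᶠ b′ cs *ᶠ partFactorᶠ (b′ ℕ.+ sum cs ℕ.+ c) c) ≈⟨ Fr.*-assoc P₀ (ΠFromᶠ b′ cs) (partFactorᶠ (b′ ℕ.+ sum cs ℕ.+ c) c) ⟨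
    (P₀ *ᶠ ΠFromᶠ b′ cs) *ᶠ partFactorᶠ (b′ ℕ.+ sum cs ℕ.+ c) c
      ≡⟨ ≡.cong (λ m → (P₀ *ᶠ ΠFromᶠ b′ cs) *ᶠ partFactorᶠ (m ℕ.+ c) c) (ℕ.+-assoc b c₀ (sum cs)) ⟩
    (P₀ *ᶠ ΠFromᶠ b′ cs) *ᶠ partFactorᶠ (b ℕ.+ (c₀ ℕ.+ sum cs) ℕ.+ c) c ∎
    where
    b′ = b ℕ.+ c₀
    P₀ = partFactorᶠ b′ c₀

  ∑Π-compositionsWithin : ∀ {f n} → n ≤ f → ∑ˡ (map Πᶠ (compositionsWithin f n)) ≈ᶠ closedFormᶠ n
  ∑Π-compositionsWithin {n = zero} _ = Fr.trans (Fr.+-identityʳ 1ᶠ) (cross (Poly.*-assoc 1P 1P 1P))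
    where module Poly = CommutativeRing Poly-commutativeRing
  ∑Π-compositionsWithin {suc f} {suc n} (s≤s n≤f) = begin
    ∑ˡ (map Πᶠ (concat (applyUpTo (withLastPart f n) (suc n))))
      ≡⟨ ≡.cong ∑ˡ (≡.trans (≡.sym (concat-map (applyUpTo (withLastPart f n) (suc n))))
                            (≡.cong concat (map-applyUpTo (withLastPart f n) (map Πᶠ) (suc n)))) ⟩
    ∑ˡ (concat (applyUpTo (map Πᶠ ∘ withLastPart f n) (suc n)))
      ≈⟨ ∑ˡ-concat-applyUpTo (map Πᶠ ∘ withLastPart f n) (suc n) ⟩
    ∑ᶠ {suc n} (λ j → ∑ˡ (map Πᶠ (withLastPart f n (toℕ j))))
      ≈⟨ ∑ᶠ-cong {suc n} (λ j → ∑Π-withLastPart (toℕ≤pred[n] j)) ⟩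
    ∑ᶠ {suc n} (λ j → closedFormᶠ (n ∸ toℕ j) *ᶠ partFactorᶠ (suc n) (suc (toℕ j)) )
      ≈⟨ closedForm-recurrence n ⟩
    closedFormᶠ (suc n) ∎
    where
    ∑Π-withLastPart : ∀ {j} → j ≤ n →
      ∑ˡ (map Πᶠ (withLastPart f n j)) ≈ᶠ closedFormᶠ (n ∸ j) *ᶠ partFactorᶠ (suc n) (suc j)
    ∑Π-withLastPart {j} j≤n = begin
      ∑ˡ (map Πᶠ (map (_∷ʳ suc j) cs))
        ≡⟨ ≡.cong ∑ˡ (≡.sym (map-∘ cs)) ⟩
      ∑ˡ (map (Πᶠ ∘ (_∷ʳ suc j)) cs)
        ≈⟨ ∑ˡ-map-*ʳ cs (All.tabulate (λ c∈cs → last-part (compositionsWithin-sound f (n ∸ j) c∈cs))) ⟩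
      ∑ˡ (map Πᶠ cs) *ᶠ T
        ≈⟨ Fr.*-congʳ {T} (∑Π-compositionsWithin {f} {n ∸ j} (ℕ.≤-trans (ℕ.m∸n≤m n j) n≤f)) ⟩
      closedFormᶠ (n ∸ j) *ᶠ T ∎
      where
      cs = compositionsWithin f (n ∸ j)
      T = partFactorᶠ (suc n) (suc j)
      last-part : ∀ {c} → IsComposition (n ∸ j) c → Πᶠ (c ∷ʳ suc j) ≈ᶠ Πᶠ c *ᶠ T
      last-part {c} (_ , sum≡n∸j) = Fr.trans (ΠFromᶠ-∷ʳ 0 c (suc j))
        (Fr.reflexive (≡.cong (λ m → Πᶠ c *ᶠ partFactorᶠ m (suc j))
                              (≡.trans (≡.cong (ℕ._+ suc j) sum≡n∸j) (m∸n+1+n≡1+m j≤n))))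

proposition2p23 : (k : ℕ) (L : List (List ℕ)) →
    (∀ c → (c ∈ L) ⇔ (All (1 ≤_) c × sum c ≡ k)) → Unique L →
    sumF (map Π L) ≈ inv (qFact k) *F rhsProd k
proposition2p23 k L L-enumerates L-unique =
  ≡.subst (_≈ inv (qFact k) *F rhsProd k) (toRatFun-∑Π L L-positive) (≈ᶠ⇒≈ ∑ΠL≈closedForm)
  where
  open PolynomialRing using (Poly-commutativeRing)
  open Fractions Poly-commutativeRing using (_≈ᶠ_; ≈ᶠ-trans; ∑ˡ; ∑ˡ-↭)
  open ClosedForm using (closedFormᶠ; ≈ᶠ⇒≈)
  open Compositions
  open CompositionSums
  open Equivalence

  L-positive : All (All (1 ≤_)) L
  L-positive = All.tabulate (λ c∈L → proj₁ (to (L-enumerates _) c∈L))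

  L↭compositions : L ↭ compositionsWithin k k
  L↭compositions = ∼bag⇒↭ (unique∧set⇒bag L-unique (compositionsWithin-unique k k) λ {c} → mk⇔
    (λ c∈L → compositionsWithin-complete ℕ.≤-refl (to (L-enumerates c) c∈L))
    (λ c∈C → from (L-enumerates c) (compositionsWithin-sound k k c∈C)))

  ∑ΠL≈closedForm : ∑ˡ (map Πᶠ L) ≈ᶠ closedFormᶠ k
  ∑ΠL≈closedForm = ≈ᶠ-trans (∑ˡ-↭ (↭.map⁺ Πᶠ L↭compositions)) (∑Π-compositionsWithin {k} {k} ℕ.≤-refl)
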